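{- Let $\Phi=\phi\llbracket\psi_1,\ldots,\psi_k\rrbracket$ be an organized formula, where either $\phi$ is a non-atomic holey $\{\exists,\wedge\}$-formula and each $\psi_i$ is an atom or a $\{\forall,\vee\}$-organized formula, or $\phi$ is a non-atomic holey $\{\forall,\vee\}$-formula and each $\psi_i$ is an atom or an $\{\exists,\wedge\}$-organized formula. Then every formula in $[\Phi]_{\mathcal{T}\setminus\{N\}}$ has the form $\phi'\llbracket\psi'_1,\ldots,\psi'_k\rrbracket$ where $\phi'\in[\phi]_{\mathcal{T}\setminus\{N\}}$ and $\psi'_i\in[\psi_i]_{\mathcal{T}\setminus\{N\}}$ for each $i=1,\ldots,k$. Here the rules are applied to $\phi$ and to holey formulas under the association $i\mapsto\mathrm{free}(\psi_i)$, $i=1,\ldots,k$.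
   Context: A pfo-formula is a relational first-order formula with no negation ($\wedge,\vee$ binary); $\mathrm{free}(\psi)$ is its set of free variables. A holey pfo-formula is built as follows: each natural number $i\ge1$ is a holey formula (a hole); if $\phi,\phi'$ are holey formulas, so are $\phi\wedge\phi'$, $\phi\vee\phi'$, $\exists x\phi$, $\forall x\phi$; no natural number occurs more than once; it is atomic if it is a single hole. Holey $\{\exists,\wedge\}$-formulas use only holes, $\wedge$, $\exists$; holey $\{\forall,\vee\}$-formulas only holes, $\vee$, $\forall$. An association for a holey formula is a partial map $a$ defined on its holes with $a(i)$ a set of variables; it determines $\mathrm{free}(\cdot)$ on subformulas via $\mathrm{free}(i)=a(i)$ and the usual inductive rules. $\phi\llbracket\psi_1,\ldots,\psi_k\rrbracket$ is obtained by substituting $\psi_i$ for hole $i$. Organized formulas are defined by mutual induction: if $\phi$ is a non-atomic holey $\{\exists,\wedge\}$-formula and each $\psi_i$ is an atom or $\{\forall,\vee\}$-organized, then $\phi\llbracket\psi_1,\ldots,\psi_k\rrbracket$ is $\{\exists,\wedge\}$-organized; dually with the roles of $\{\exists,\wedge\}$ and $\{\forall,\vee\}$ exchanged. Rewriting rules (applicable to any subformula occurrence; $\oplus\in\{\wedge,\vee\}$, $Q\in\{\exists,\forall\}$): $A$: $F_1\oplus(F_2\oplus F_3)\to(F_1\oplus F_2)\oplus F_3$ and its converse; $C$: $F_1\oplus F_2\to F_2\oplus F_1$; $O$: $QxQyF\to QyQxF$; $P\!\downarrow$: $\exists x(F_1\wedge F_2)\to(\exists xF_1)\wedge F_2$ and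 $\forall x(F_1\vee F_2)\to(\forall xF_1)\vee F_2$ whenever $x\notin\mathrm{free}(F_2)$; $P\!\uparrow$: inverse of $P\!\downarrow$. $[\psi]_{\mathcal{T}\setminus\{N\}}$ is the class of $\psi$ under the reflexive-transitive closure of the union of the rules $A,C,O,P\!\downarrow,P\!\uparrow$ and their inverses. -}

module Defs where

open import Data.Nat using (ℕ)
open import Data.Fin using (Fin)
open import Data.List using (List; []; _∷_; _++_; allFin)
open import Data.List.Membership.Propositional using (_∈_)
open import Data.List.Relation.Binary.Permutation.Propositional using (_↭_)
open import Data.Product using (_×_; Σ; _,_)
open import Data.Sum using (_⊎_)
open import Relation.Nullary using (¬_)
open import Data.Empty using (⊥)
open import Data.Unit using (⊤)
open import Relation.Binary.PropositionalEquality using (_≡_; _≢_)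
open import Relation.Binary.Construct.Closure.Equivalence using (EqClosure)

Var : Set
Var = ℕ

data Op : Set where
  ∧′ ∨′ : Op

data Qu : Set where
  ∃′ ∀′ : Qu

opOf : Qu → Op
opOf ∃′ = ∧′
opOf ∀′ = ∨′

dual : Qu → Qu
dual ∃′ = ∀′
dual ∀′ = ∃′

-- Negation-free first-order formulas whose leaves are of type L.
-- L = Atom gives pfo-formulas, L = Fin k gives holey formulas with holes 1..k.
data Form (L : Set) : Set where
  leaf : L → Form L
  bin  : Op → Form L → Form L → Form L
  qu   : Qu → Var → Form L → Form L

record Atom : Set where
  constructor rel
  field
    symb : ℕ
    args : List Var

PFO : Set
PFO = Form Atom

-- Free variables, parameterised by the free variables of the leaves
-- (for holey formulas this is an association).
Free : {L : Set} → (L → Var → Set) → Form L → Var → Set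
Free fv (leaf l)    x = fv l x
Free fv (bin _ F G) x = Free fv F x ⊎ Free fv G x
Free fv (qu _ y F)  x = x ≢ y × Free fv F x

atomFree : Atom → Var → Set
atomFree a x = x ∈ Atom.args a

free : PFO → Var → Set
free = Free atomFree

data Step {L : Set} (fv : L → Var → Set) : Form L → Form L → Set where
  A→  : ∀ o F₁ F₂ F₃ → Step fv (bin o F₁ (bin o F₂ F₃)) (bin o (bin o F₁ F₂) F₃)
  A←  : ∀ o F₁ F₂ F₃ → Step fv (bin o (bin o F₁ F₂) F₃) (bin o F₁ (bin o F₂ F₃))
  C   : ∀ o F₁ F₂ → Step fv (bin o F₁ F₂) (bin o F₂ F₁)
  O   : ∀ q x y F → Step fv (qu q x (qu q y F)) (qu q y (qu q x F))
  P↓  : ∀ q x F₁ F₂ → ¬ Free fv F₂ x →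
        Step fv (qu q x (bin (opOf q) F₁ F₂)) (bin (opOf q) (qu q x F₁) F₂)
  P↑  : ∀ q x F₁ F₂ → ¬ Free fv F₂ x →
        Step fv (bin (opOf q) (qu q x F₁) F₂) (qu q x (bin (opOf q) F₁ F₂))
  binˡ : ∀ o {F F′} G → Step fv F F′ → Step fv (bin o F G) (bin o F′ G)
  binʳ : ∀ o F {G G′} → Step fv G G′ → Step fv (bin o F G) (bin o F G′)
  quᶜ  : ∀ q x {F F′} → Step fv F F′ → Step fv (qu q x F) (qu q x F′)

Equiv : {L : Set} → (L → Var → Set) → Form L → Form L → Set
Equiv fv = EqClosure (Step fv)

-- [ψ]_{T∖{N}} membership for pfo-formulas.
_≈T_ : PFO → PFO → Set
_≈T_ = Equiv atomFree

_⟦_⟧ : {k : ℕ} → Form (Fin k) → (Fin k → PFO) → PFO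
leaf i    ⟦ ψ ⟧ = ψ i
bin o F G ⟦ ψ ⟧ = bin o (F ⟦ ψ ⟧) (G ⟦ ψ ⟧)
qu q x F  ⟦ ψ ⟧ = qu q x (F ⟦ ψ ⟧)

holes : {L : Set} → Form L → List L
holes (leaf l)    = l ∷ []
holes (bin _ F G) = holes F ++ holes G
holes (qu _ _ F)  = holes F

HolesExactly : {k : ℕ} → Form (Fin k) → Set
HolesExactly {k} φ = holes φ ↭ allFin k

-- Holey {∃,∧}-formula (q = ∃′) resp. {∀,∨}-formula (q = ∀′).
data InFragment {L : Set} (q : Qu) : Form L → Set where
  leaf : ∀ l → InFragment q (leaf l)
  bin  : ∀ {F G} → InFragment q F → InFragment q G → InFragment q (bin (opOf q) F G)
  qu   : ∀ x {F} → InFragment q F → InFragment q (qu q x F)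

NonAtomic : {L : Set} → Form L → Set
NonAtomic (leaf _) = ⊥
NonAtomic _        = ⊤

IsAtom : PFO → Set
IsAtom F = Σ Atom (λ a → F ≡ leaf a)

data Organized (q : Qu) : PFO → Set where
  org : ∀ {k} (φ : Form (Fin k)) (ψ : Fin k → PFO) →
        InFragment q φ → HolesExactly φ → NonAtomic φ →
        (∀ i → IsAtom (ψ i) ⊎ Organized (dual q) (ψ i)) →
        Organized q (φ ⟦ ψ ⟧)

assoc : {k : ℕ} → (Fin k → PFO) → Fin k → Var → Set
assoc ψ i = free (ψ i)

{-# OPTIONS --safe #-}
-- Let Φ = φ ⟦ ψ ⟧.  As φ uses only q-connectives and q-quantifiers while every
-- filler ψ i is an atom or headed by the dual kind, φ is exactly the maximal
-- q-part of Φ.  A redex rooted at a q-node consists of q-nodes only (A, O, P↓,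
-- P↑) or of the root alone (C), and no rule changes the kind of the root of a
-- formula; so every step either rewrites φ or stays inside one filler, the holes
-- being distinct.  Steps preserve free variables, hence a step of φ is also
-- valid under the original association i ↦ free (ψ i), and the decomposition
-- persists along any chain of steps and inverse steps.
module Submission where

open import Defs
open import Data.Nat using (ℕ)
open import Data.Fin using (Fin; _≟_)
open import Data.Product using (Σ; _×_; _,_)
open import Data.Sum using (_⊎_; inj₁; inj₂)
open import Data.Empty using (⊥-elim)
open import Data.List using (List; []; _∷_; _++_)
open import Data.List.Properties using (++-assoc)
open import Data.List.Membership.Propositional using (_∈_; _∉_)
open import Data.List.Membership.Propositional.Properties using (∈-++⁺ˡ; ∈-++⁺ʳ)
open import Data.List.Relation.Unary.Any using (here; there)
open import Data.List.Relation.Unary.All using (lookup)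
open import Data.List.Relation.Unary.All.Properties using (++⁻ˡ; ++⁻ʳ)
open import Data.List.Relation.Unary.AllPairs using ([]; _∷_)
open import Data.List.Relation.Unary.Unique.Propositional using (Unique)
open import Data.List.Relation.Unary.Unique.Propositional.Properties using (allFin⁺)
open import Data.List.Relation.Binary.Disjoint.Propositional using (Disjoint)
open import Data.List.Relation.Binary.Permutation.Propositional
  using (_↭_; ↭-sym; ↭-reflexive; ↭-refl; ↭⇒↭ₛ)
open import Data.List.Relation.Binary.Permutation.Propositional.Properties
  using (++-comm; ++⁺ˡ; ++⁺ʳ)
import Data.List.Relation.Binary.Permutation.Setoid.Properties as PermutationSetoid
open import Data.Vec.Functional using (updateAt)
open import Data.Vec.Functional.Properties using (updateAt-updates; updateAt-minimal)
open import Function using (const; _∘_)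
open import Relation.Nullary using (¬_; yes; no)
open import Relation.Binary.PropositionalEquality
  using (_≡_; refl; sym; cong; cong₂; subst; setoid)
open import Relation.Binary.Construct.Closure.ReflexiveTransitive using (ε; _◅_)
open import Relation.Binary.Construct.Closure.Symmetric using (fwd; bwd)
open import Relation.Binary.Construct.Closure.Equivalence using (transitive; return)

Unique-resp-↭ : {A : Set} {xs ys : List A} → xs ↭ ys → Unique xs → Unique ys
Unique-resp-↭ = PermutationSetoid.Unique-resp-↭ (setoid _) ∘ ↭⇒↭ₛ

Unique-++⁻ : {A : Set} (xs : List A) {ys : List A} → Unique (xs ++ ys) →
             Unique xs × Unique ys × Disjoint xs ys
Unique-++⁻ []       u                = [] , u , λ { (() , _) }
Unique-++⁻ (x ∷ xs) (x∉xs++ys ∷ u) with Unique-++⁻ xs u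
... | uxs , uys , xs#ys = ++⁻ˡ xs x∉xs++ys ∷ uxs , uys , x∷xs#ys
  where
  x∷xs#ys : Disjoint (x ∷ xs) _
  x∷xs#ys (here refl , v∈ys) = lookup (++⁻ʳ xs x∉xs++ys) v∈ys refl
  x∷xs#ys (there v∈xs , v∈ys) = xs#ys (v∈xs , v∈ys)

pointwise-updateAt : {n : ℕ} {A B : Set} (R : A → B → Set)
                     {xs : Fin n → A} {ys : Fin n → B} (i : Fin n) {y : B} →
                     (∀ j → R (xs j) (ys j)) → R (xs i) y →
                     ∀ j → R (xs j) (updateAt ys i (const y) j)
pointwise-updateAt R {xs} {ys} i Rxsys Rxy j with j ≟ i
... | yes refl = subst (R (xs i)) (sym (updateAt-updates i ys)) Rxy
... | no  j≢i  = subst (R (xs j)) (sym (updateAt-minimal j i ys j≢i)) (Rxsys j)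

module _ {L : Set} {fv : L → Var → Set} where

  Step-sym : ∀ {F G} → Step fv F G → Step fv G F
  Step-sym (A→ o F₁ F₂ F₃)   = A← o F₁ F₂ F₃
  Step-sym (A← o F₁ F₂ F₃)   = A→ o F₁ F₂ F₃
  Step-sym (C o F₁ F₂)       = C o F₂ F₁
  Step-sym (O q x y F)       = O q y x F
  Step-sym (P↓ q x F₁ F₂ x∉) = P↑ q x F₁ F₂ x∉
  Step-sym (P↑ q x F₁ F₂ x∉) = P↓ q x F₁ F₂ x∉
  Step-sym (binˡ o G s)      = binˡ o G (Step-sym s)
  Step-sym (binʳ o F s)      = binʳ o F (Step-sym s)
  Step-sym (quᶜ q x s)       = quᶜ q x (Step-sym s)

  Free-step : ∀ {F G x} → Step fv F G → Free fv F x → Free fv G x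
  Free-step (A→ _ _ _ _)      (inj₁ f)         = inj₁ (inj₁ f)
  Free-step (A→ _ _ _ _)      (inj₂ (inj₁ f))  = inj₁ (inj₂ f)
  Free-step (A→ _ _ _ _)      (inj₂ (inj₂ f))  = inj₂ f
  Free-step (A← _ _ _ _)      (inj₁ (inj₁ f))  = inj₁ f
  Free-step (A← _ _ _ _)      (inj₁ (inj₂ f))  = inj₂ (inj₁ f)
  Free-step (A← _ _ _ _)      (inj₂ f)         = inj₂ (inj₂ f)
  Free-step (C _ _ _)         (inj₁ f)         = inj₂ f
  Free-step (C _ _ _)         (inj₂ f)         = inj₁ f
  Free-step (O _ _ _ _)       (x≢y , x≢z , f)  = x≢z , x≢y , f
  Free-step (P↓ _ _ _ _ _)    (x≢y , inj₁ f)   = inj₁ (x≢y , f)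
  Free-step (P↓ _ _ _ _ _)    (_ , inj₂ f)     = inj₂ f
  Free-step (P↑ _ _ _ _ _)    (inj₁ (x≢y , f)) = x≢y , inj₁ f
  Free-step (P↑ _ _ _ _ y∉F₂) (inj₂ f)         = (λ { refl → y∉F₂ f }) , inj₂ f
  Free-step (binˡ _ _ s)      (inj₁ f)         = inj₁ (Free-step s f)
  Free-step (binˡ _ _ s)      (inj₂ f)         = inj₂ f
  Free-step (binʳ _ _ s)      (inj₁ f)         = inj₁ f
  Free-step (binʳ _ _ s)      (inj₂ f)         = inj₂ (Free-step s f)
  Free-step (quᶜ _ _ s)       (x≢y , f)        = x≢y , Free-step s f

  Free-resp-Equiv : ∀ {F G x} → Equiv fv F G → Free fv F x → Free fv G x
  Free-resp-Equiv ε           f = f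
  Free-resp-Equiv (fwd s ◅ r) f = Free-resp-Equiv r (Free-step s f)
  Free-resp-Equiv (bwd s ◅ r) f = Free-resp-Equiv r (Free-step (Step-sym s) f)

  holes-↭ : ∀ {F G} → Step fv F G → holes F ↭ holes G
  holes-↭ (A→ _ F₁ F₂ F₃) = ↭-reflexive (sym (++-assoc (holes F₁) (holes F₂) (holes F₃)))
  holes-↭ (A← _ F₁ F₂ F₃) = ↭-reflexive (++-assoc (holes F₁) (holes F₂) (holes F₃))
  holes-↭ (C _ F₁ F₂)     = ++-comm (holes F₁) (holes F₂)
  holes-↭ (O _ _ _ _)     = ↭-refl
  holes-↭ (P↓ _ _ _ _ _)  = ↭-refl
  holes-↭ (P↑ _ _ _ _ _)  = ↭-refl
  holes-↭ (binˡ _ G s)    = ++⁺ʳ (holes G) (holes-↭ s)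
  holes-↭ (binʳ _ F s)    = ++⁺ˡ (holes F) (holes-↭ s)
  holes-↭ (quᶜ _ _ s)     = holes-↭ s

module _ {L : Set} {fv fv′ : L → Var → Set} (fv⊆fv′ : ∀ {l x} → fv l x → fv′ l x) where

  Free-mono : ∀ F {x} → Free fv F x → Free fv′ F x
  Free-mono (leaf l)    f         = fv⊆fv′ f
  Free-mono (bin _ F G) (inj₁ f)  = inj₁ (Free-mono F f)
  Free-mono (bin _ F G) (inj₂ f)  = inj₂ (Free-mono G f)
  Free-mono (qu _ _ F)  (x≢y , f) = x≢y , Free-mono F f

  Step-antimono : ∀ {F G} → Step fv′ F G → Step fv F G
  Step-antimono (A→ o F₁ F₂ F₃)   = A→ o F₁ F₂ F₃
  Step-antimono (A← o F₁ F₂ F₃)   = A← o F₁ F₂ F₃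
  Step-antimono (C o F₁ F₂)       = C o F₁ F₂
  Step-antimono (O q x y F)       = O q x y F
  Step-antimono (P↓ q x F₁ F₂ x∉) = P↓ q x F₁ F₂ (x∉ ∘ Free-mono F₂)
  Step-antimono (P↑ q x F₁ F₂ x∉) = P↑ q x F₁ F₂ (x∉ ∘ Free-mono F₂)
  Step-antimono (binˡ o G s)      = binˡ o G (Step-antimono s)
  Step-antimono (binʳ o F s)      = binʳ o F (Step-antimono s)
  Step-antimono (quᶜ q x s)       = quᶜ q x (Step-antimono s)

data Headed {L : Set} (q : Qu) : Form L → Set where
  bin : ∀ {F G} → Headed q (bin (opOf q) F G)
  qu  : ∀ {x F} → Headed q (qu q x F)

module _ {L : Set} {fv : L → Var → Set} where

  Headed-step : ∀ {q F G} → Step fv F G → Headed q F → Headed q G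
  Headed-step       (A→ _ _ _ _)    bin = bin
  Headed-step       (A← _ _ _ _)    bin = bin
  Headed-step       (C _ _ _)       bin = bin
  Headed-step       (O _ _ _ _)     qu  = qu
  Headed-step       (P↓ _ _ _ _ _)  qu  = bin
  Headed-step {∃′}  (P↑ ∃′ _ _ _ _) bin = qu
  Headed-step {∀′}  (P↑ ∀′ _ _ _ _) bin = qu
  Headed-step       (binˡ _ _ _)    bin = bin
  Headed-step       (binʳ _ _ _)    bin = bin
  Headed-step       (quᶜ _ _ _)     qu  = qu

Headed-dual : ∀ {L : Set} {q} {F : Form L} → Headed (dual q) F → ¬ Headed q F
Headed-dual {q = ∃′} bin ()
Headed-dual {q = ∃′} qu  ()
Headed-dual {q = ∀′} bin ()
Headed-dual {q = ∀′} qu  ()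

⟦⟧-headed : ∀ {q k} {φ : Form (Fin k)} (ψ : Fin k → PFO) →
            InFragment q φ → NonAtomic φ → Headed q (φ ⟦ ψ ⟧)
⟦⟧-headed ψ (bin _ _) _ = bin
⟦⟧-headed ψ (qu _ _)  _ = qu

Organized-headed : ∀ {q F} → Organized q F → Headed q F
Organized-headed (org _ ψ φ-frag _ φ-nonatomic _) = ⟦⟧-headed ψ φ-frag φ-nonatomic

filler-unheaded : ∀ {q F} → IsAtom F ⊎ Organized (dual q) F → ¬ Headed q F
filler-unheaded (inj₁ (_ , refl)) ()
filler-unheaded (inj₂ F-org)      = Headed-dual (Organized-headed F-org)

-- φ is the maximal q-part of Φ = φ ⟦ ψ ⟧.  The leaf case keeps the equation
-- ψ i ≡ Φ so that a step out of Φ can be analysed by pattern matching.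
data Frame (q : Qu) {k : ℕ} (ψ : Fin k → PFO) : Form (Fin k) → PFO → Set where
  leaf : ∀ i {Φ} → ψ i ≡ Φ → ¬ Headed q Φ → Frame q ψ (leaf i) Φ
  bin  : ∀ {F G A B} → Frame q ψ F A → Frame q ψ G B →
         Frame q ψ (bin (opOf q) F G) (bin (opOf q) A B)
  qu   : ∀ x {F A} → Frame q ψ F A → Frame q ψ (qu q x F) (qu q x A)

data FrameStep (q : Qu) {k : ℕ} (ψ : Fin k → PFO) (φ : Form (Fin k)) (Φ : PFO) : Set where
  inFrame  : ∀ {φ′} → Step (assoc ψ) φ φ′ → Frame q ψ φ′ Φ → FrameStep q ψ φ Φ
  inFiller : ∀ {i X} → i ∈ holes φ → Step atomFree (ψ i) X →
             Frame q (updateAt ψ i (const X)) φ Φ → FrameStep q ψ φ Φ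

module _ {q : Qu} {k : ℕ} where

  Frame-⟦⟧ : {φ : Form (Fin k)} {ψ : Fin k → PFO} →
             InFragment q φ → (∀ i → ¬ Headed q (ψ i)) → Frame q ψ φ (φ ⟦ ψ ⟧)
  Frame-⟦⟧ (leaf i)  unheaded = leaf i refl (unheaded i)
  Frame-⟦⟧ (bin F G) unheaded = bin (Frame-⟦⟧ F unheaded) (Frame-⟦⟧ G unheaded)
  Frame-⟦⟧ (qu x F)  unheaded = qu x (Frame-⟦⟧ F unheaded)

  Frame⇒≡⟦⟧ : {φ : Form (Fin k)} {ψ : Fin k → PFO} {Φ : PFO} → Frame q ψ φ Φ → Φ ≡ φ ⟦ ψ ⟧
  Frame⇒≡⟦⟧ (leaf _ ψi≡Φ _) = sym ψi≡Φ
  Frame⇒≡⟦⟧ (bin F G)       = cong₂ (bin _) (Frame⇒≡⟦⟧ F) (Frame⇒≡⟦⟧ G)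
  Frame⇒≡⟦⟧ (qu x F)        = cong (qu q x) (Frame⇒≡⟦⟧ F)

  Frame-free : {φ : Form (Fin k)} {ψ : Fin k → PFO} {Φ : PFO} {x : Var} →
               Frame q ψ φ Φ → Free (assoc ψ) φ x → free Φ x
  Frame-free (leaf _ refl _) f         = f
  Frame-free (bin F _)       (inj₁ f)  = inj₁ (Frame-free F f)
  Frame-free (bin _ G)       (inj₂ f)  = inj₂ (Frame-free G f)
  Frame-free (qu _ F)        (x≢y , f) = x≢y , Frame-free F f

  Frame-cong : {φ : Form (Fin k)} {ψ ψ′ : Fin k → PFO} {Φ : PFO} →
               (∀ {j} → j ∈ holes φ → ψ j ≡ ψ′ j) → Frame q ψ φ Φ → Frame q ψ′ φ Φ
  Frame-cong ψ≡ψ′ (leaf i ψi≡Φ Φ-unheaded) =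
    leaf i (subst (_≡ _) (ψ≡ψ′ (here refl)) ψi≡Φ) Φ-unheaded
  Frame-cong ψ≡ψ′ (bin {F} F-frame G-frame) =
    bin (Frame-cong (ψ≡ψ′ ∘ ∈-++⁺ˡ) F-frame) (Frame-cong (ψ≡ψ′ ∘ ∈-++⁺ʳ (holes F)) G-frame)
  Frame-cong ψ≡ψ′ (qu x F-frame) = qu x (Frame-cong ψ≡ψ′ F-frame)

  Frame-updateAt-∉ : {φ : Form (Fin k)} {ψ : Fin k → PFO} {Φ : PFO} {i : Fin k}
                     {f : PFO → PFO} →
                     i ∉ holes φ → Frame q ψ φ Φ → Frame q (updateAt ψ i f) φ Φ
  Frame-updateAt-∉ {ψ = ψ} {i = i} i∉φ =
    Frame-cong (λ {j} j∈φ → sym (updateAt-minimal j i ψ λ { refl → i∉φ j∈φ }))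

  FrameStep-binˡ : {ψ : Fin k → PFO} {F G : Form (Fin k)} {A B : PFO} →
                   Disjoint (holes F) (holes G) → Frame q ψ G B → FrameStep q ψ F A →
                   FrameStep q ψ (bin (opOf q) F G) (bin (opOf q) A B)
  FrameStep-binˡ {G = G} F#G G-frame (inFrame s F′-frame) =
    inFrame (binˡ _ G s) (bin F′-frame G-frame)
  FrameStep-binˡ F#G G-frame (inFiller i∈F s F-frame) =
    inFiller (∈-++⁺ˡ i∈F) s
      (bin F-frame (Frame-updateAt-∉ (λ i∈G → F#G (i∈F , i∈G)) G-frame))

  FrameStep-binʳ : {ψ : Fin k → PFO} {F G : Form (Fin k)} {A B : PFO} →
                   Disjoint (holes F) (holes G) → Frame q ψ F A → FrameStep q ψ G B →
                   FrameStep q ψ (bin (opOf q) F G) (bin (opOf q) A B)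
  FrameStep-binʳ {F = F} F#G F-frame (inFrame s G′-frame) =
    inFrame (binʳ _ F s) (bin F-frame G′-frame)
  FrameStep-binʳ {F = F} F#G F-frame (inFiller i∈G s G-frame) =
    inFiller (∈-++⁺ʳ (holes F) i∈G) s
      (bin (Frame-updateAt-∉ (λ i∈F → F#G (i∈F , i∈G)) F-frame) G-frame)

  FrameStep-qu : {ψ : Fin k → PFO} {F : Form (Fin k)} {A : PFO} (x : Var) →
                 FrameStep q ψ F A → FrameStep q ψ (qu q x F) (qu q x A)
  FrameStep-qu x (inFrame s F′-frame)      = inFrame (quᶜ q x s) (qu x F′-frame)
  FrameStep-qu x (inFiller i∈F s F-frame) = inFiller i∈F s (qu x F-frame)

opOf-injective : ∀ {q q′} → opOf q ≡ opOf q′ → q ≡ q′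
opOf-injective {∃′} {∃′} refl = refl
opOf-injective {∃′} {∀′} ()
opOf-injective {∀′} {∃′} ()
opOf-injective {∀′} {∀′} refl = refl

Frame-step : {q : Qu} {k : ℕ} {ψ : Fin k → PFO} {φ : Form (Fin k)} {Φ Φ′ : PFO} →
             Unique (holes φ) → Frame q ψ φ Φ → Step atomFree Φ Φ′ → FrameStep q ψ φ Φ′

-- The connective is a variable o ≡ opOf q: matching a P↑ redex against
-- bin (opOf q) A B would require inverting opOf.
Frame-step-bin : {q : Qu} {k : ℕ} {ψ : Fin k → PFO} {F G : Form (Fin k)} {o : Op}
                 {A B Φ′ : PFO} →
                 Step atomFree (bin o A B) Φ′ → o ≡ opOf q → Unique (holes F ++ holes G) →
                 Frame q ψ F A → Frame q ψ G B → FrameStep q ψ (bin (opOf q) F G) Φ′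
Frame-step-bin (C _ _ _) refl _ F G = inFrame (C _ _ _) (bin G F)
Frame-step-bin (A→ _ _ _ _) refl _ F (bin G H) = inFrame (A→ _ _ _ _) (bin (bin F G) H)
Frame-step-bin (A→ _ _ _ _) refl _ _ (leaf _ _ unheaded) = ⊥-elim (unheaded bin)
Frame-step-bin (A← _ _ _ _) refl _ (bin F G) H = inFrame (A← _ _ _ _) (bin F (bin G H))
Frame-step-bin (A← _ _ _ _) refl _ (leaf _ _ unheaded) _ = ⊥-elim (unheaded bin)
Frame-step-bin (P↑ q _ _ _ x∉G) _ _ (qu x F) G =
  inFrame (P↑ q x _ _ (x∉G ∘ Frame-free G)) (qu x (bin F G))
Frame-step-bin (P↑ _ _ _ _ _) o≡ _ (leaf _ _ unheaded) _ with refl ← opOf-injective o≡ =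
  ⊥-elim (unheaded qu)
Frame-step-bin {F = F} (binˡ _ _ s) refl u F-frame G-frame =
  let uF , _ , F#G = Unique-++⁻ (holes F) u
  in  FrameStep-binˡ F#G G-frame (Frame-step uF F-frame s)
Frame-step-bin {F = F} (binʳ _ _ s) refl u F-frame G-frame =
  let _ , uG , F#G = Unique-++⁻ (holes F) u
  in  FrameStep-binʳ F#G F-frame (Frame-step uG G-frame s)

Frame-step {ψ = ψ} _ (leaf i refl unheaded) s =
  inFiller (here refl) s (leaf i (updateAt-updates i ψ) (unheaded ∘ Headed-step (Step-sym s)))
Frame-step u (bin F G) s = Frame-step-bin s refl u F G
Frame-step _ (qu x (qu y F)) (O _ _ _ _) = inFrame (O _ x y _) (qu y (qu x F))
Frame-step _ (qu _ (leaf _ _ unheaded)) (O _ _ _ _) = ⊥-elim (unheaded qu)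
Frame-step _ (qu x (bin F G)) (P↓ _ _ _ _ x∉G) =
  inFrame (P↓ _ x _ _ (x∉G ∘ Frame-free G)) (bin (qu x F) G)
Frame-step _ (qu _ (leaf _ _ unheaded)) (P↓ _ _ _ _ _) = ⊥-elim (unheaded bin)
Frame-step u (qu x F) (quᶜ _ _ s) = FrameStep-qu x (Frame-step u F s)

record Decomposition (q : Qu) {k : ℕ} (φ : Form (Fin k)) (ψ : Fin k → PFO) (Φ : PFO) : Set where
  field
    φ′     : Form (Fin k)
    ψ′     : Fin k → PFO
    frames : Frame q ψ′ φ′ Φ
    linear : Unique (holes φ′)
    φ≈φ′   : Equiv (assoc ψ) φ φ′
    ψ≈ψ′   : ∀ i → ψ i ≈T ψ′ i

module _ {q : Qu} {k : ℕ} {φ : Form (Fin k)} {ψ : Fin k → PFO} where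

  Decomposition-⟦⟧ : InFragment q φ → HolesExactly φ → (∀ i → ¬ Headed q (ψ i)) →
                     Decomposition q φ ψ (φ ⟦ ψ ⟧)
  Decomposition-⟦⟧ φ-frag φ-holes unheaded = record
    { φ′ = φ ; ψ′ = ψ ; frames = Frame-⟦⟧ φ-frag unheaded
    ; linear = Unique-resp-↭ (↭-sym φ-holes) (allFin⁺ k)
    ; φ≈φ′ = ε ; ψ≈ψ′ = λ _ → ε }

  Decomposition-step : {Φ₁ Φ₂ : PFO} → Decomposition q φ ψ Φ₁ → Step atomFree Φ₁ Φ₂ →
                       Decomposition q φ ψ Φ₂
  Decomposition-step {Φ₂ = Φ₂} d s = next (Frame-step linear frames s)
    where
    open Decomposition d
    next : FrameStep q ψ′ φ′ Φ₂ → Decomposition q φ ψ Φ₂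
    next (inFrame st frames′) = record
      { φ′ = _ ; ψ′ = ψ′ ; frames = frames′ ; linear = Unique-resp-↭ (holes-↭ st) linear
      ; φ≈φ′ = transitive _ φ≈φ′ (return (Step-antimono (Free-resp-Equiv (ψ≈ψ′ _)) st))
      ; ψ≈ψ′ = ψ≈ψ′ }
    next (inFiller {i} _ st frames′) = record
      { φ′ = φ′ ; ψ′ = updateAt ψ′ i (const _) ; frames = frames′ ; linear = linear
      ; φ≈φ′ = φ≈φ′
      ; ψ≈ψ′ = pointwise-updateAt _≈T_ i ψ≈ψ′ (transitive _ (ψ≈ψ′ i) (return st)) }

  Decomposition-≈T : {Φ₁ Φ₂ : PFO} → Decomposition q φ ψ Φ₁ → Φ₁ ≈T Φ₂ →
                     Decomposition q φ ψ Φ₂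
  Decomposition-≈T d ε           = d
  Decomposition-≈T d (fwd s ◅ r) = Decomposition-≈T (Decomposition-step d s) r
  Decomposition-≈T d (bwd s ◅ r) = Decomposition-≈T (Decomposition-step d (Step-sym s)) r

proposition5p6 : (q : Qu) (k : ℕ) (φ : Form (Fin k)) (ψ : Fin k → PFO) →
                 InFragment q φ → HolesExactly φ → NonAtomic φ →
                 (∀ i → IsAtom (ψ i) ⊎ Organized (dual q) (ψ i)) →
                 (Φ′ : PFO) → (φ ⟦ ψ ⟧) ≈T Φ′ →
                 Σ (Form (Fin k)) (λ φ′ → Σ (Fin k → PFO) (λ ψ′ →
                   (Φ′ ≡ φ′ ⟦ ψ′ ⟧) × Equiv (assoc ψ) φ φ′ × (∀ i → ψ i ≈T ψ′ i)))
proposition5p6 q k φ ψ φ-frag φ-holes _ fillers Φ′ Φ≈Φ′ =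
  φ′ , ψ′ , Frame⇒≡⟦⟧ frames , φ≈φ′ , ψ≈ψ′
  where
  open Decomposition
    (Decomposition-≈T (Decomposition-⟦⟧ φ-frag φ-holes (filler-unheaded ∘ fillers)) Φ≈Φ′)
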